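{- For every integer $m\ge 1$, the connected component of ${\cal D}_m$ containing the vertex $e^m$ coincides with the connected component containing the vertex $b^m$ if and only if $m$ is even.
   Context: The alpha-letters are the 2-element subsets of $\{\text{up},\text{down},\text{left},\text{right}\}$: $a=\{\text{right},\text{down}\}$, $b=\{\text{up},\text{down}\}$, $c=\{\text{right},\text{up}\}$, $d=\{\text{left},\text{down}\}$, $e=\{\text{left},\text{right}\}$, $f=\{\text{left},\text{up}\}$. ${\cal D}_{ud}$ is the digraph (loops allowed) on $\{a,\dots,f\}$ with an arc $(\alpha,\beta)$ iff ($\text{down}\in\alpha\iff\text{up}\in\beta$); ${\cal D}_{lr}$ has an arc $(\alpha,\beta)$ iff ($\text{right}\in\alpha\iff\text{left}\in\beta$). ${\cal D}_m$ is the digraph whose vertices are all words $\alpha_1\cdots\alpha_m\in\{a,\dots,f\}^m$ with $(\alpha_i,\alpha_{i+1})$ an arc of ${\cal D}_{ud}$ for all $1\le i\le m$ ($\alpha_{m+1}:=\alpha_1$), and with an arc $v\to u$ iff $(v_i,u_i)$ is an arc of ${\cal D}_{lr}$ for every $i$. $e^m$ and $b^m$ denote the constant words. Connected components are those of the underlying undirected graph. -}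

module Defs where

open import Data.Nat using (ℕ; zero; suc)
open import Data.Fin using (Fin; zero; suc; toℕ; fromℕ<)
import Data.Nat as ℕ
open import Relation.Nullary using (yes; no)
open import Data.Bool using (Bool; true; false; _∧_)
open import Data.Product using (Σ; _,_; proj₁)
open import Data.Sum using (_⊎_)
open import Relation.Binary.PropositionalEquality using (_≡_; refl)
open import Relation.Binary.Construct.Closure.ReflexiveTransitive using (Star)

data Dir : Set where
  up down left right : Dir

-- the six alpha-letters (2-element subsets of the four directions)
data Letter : Set where
  a b c d e f : Letter

_∈L_ : Dir → Letter → Bool
right ∈L a = true
down  ∈L a = true
up    ∈L b = true
down  ∈L b = true
right ∈L c = true
up    ∈L c = true
left  ∈L d = true
down  ∈L d = true
left  ∈L e = true
right ∈L e = true
left  ∈L f = true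
up    ∈L f = true
_     ∈L _ = false

ArcUD : Letter → Letter → Set
ArcUD α β = (down ∈L α) ≡ (up ∈L β)

ArcLR : Letter → Letter → Set
ArcLR α β = (right ∈L α) ≡ (left ∈L β)

-- cyclic successor on Fin m : i ↦ i+1, with the last index m-1 sent to 0
next : ∀ {m} → Fin m → Fin m
next {suc n} i with toℕ i ℕ.<? n
... | yes i<n = suc (fromℕ< i<n)
... | no  _   = zero

Word : ℕ → Set
Word m = Fin m → Letter

Vertex : ℕ → Set
Vertex m = Σ (Word m) λ w → (i : Fin m) → ArcUD (w i) (w (next i))

Arc : ∀ {m} → Vertex m → Vertex m → Set
Arc {m} v u = (i : Fin m) → ArcLR (proj₁ v i) (proj₁ u i)

Adj : ∀ {m} → Vertex m → Vertex m → Set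
Adj v u = Arc v u ⊎ Arc u v

SameComponent : ∀ {m} → Vertex m → Vertex m → Set
SameComponent = Star Adj

eᵐ : (m : ℕ) → Vertex m
eᵐ m = (λ _ → e) , (λ _ → refl)

bᵐ : (m : ℕ) → Vertex m
bᵐ m = (λ _ → b) , (λ _ → refl)

{-# OPTIONS --safe #-}
-- Count, modulo 2, the letters of a vertex that contain left. Every letter has
-- exactly two directions, so left + right ≡ up + down (mod 2) letterwise, and
-- summing around the cycle the ups and downs cancel because down ∈ αᵢ ⇔ up ∈ αᵢ₊₁.
-- Hence a vertex has as many lefts as rights mod 2, and an arc v → u turns the
-- rights of v into the lefts of u: the left count mod 2 is constant on components.
-- It is m mod 2 at eᵐ and 0 at bᵐ. Conversely, for even m the alternating word
-- dfdf⋯df is a vertex with arcs eᵐ → dfdf⋯df → bᵐ.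
module Submission where

open import Defs
open import Level using (0ℓ)
open import Algebra.Bundles using (CommutativeMonoid; CommutativeRing)
import Algebra.Properties.CommutativeMonoid.Sum as CommutativeMonoidSum
open import Data.Bool using (Bool; true; false; _xor_)
open import Data.Bool.Properties
  using (xor-∧-commutativeRing; xor-same; xor-identityʳ; not-involutive)
open import Data.Fin using (Fin; zero; suc; toℕ; fromℕ; inject₁)
open import Data.Fin.Properties using (toℕ-injective; toℕ<n; toℕ-fromℕ; toℕ-fromℕ<; toℕ-inject₁)
open import Data.Nat using (ℕ; zero; suc; _<_; _≥_; _*_; _<?_; s≤s; z≤n; parity)
open import Data.Nat.Divisibility using (_∣_; divides; ∣-refl; ∣m∣n⇒∣m+n)
open import Data.Nat.Properties using (<-irrefl)
open import Data.Parity.Base using (Parity; 0ℙ; 1ℙ; _⁻¹)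
open import Data.Parity.Properties using (suc-homo-⁻¹)
open import Data.Product using (_,_)
open import Data.Sum using (inj₁; inj₂)
open import Data.Vec.Functional using (Vector)
open import Function using (_∘_)
open import Function.Bundles using (_⇔_; mk⇔)
open import Relation.Binary.Construct.Closure.ReflexiveTransitive using (ε; _◅_)
open import Relation.Binary.PropositionalEquality
  using (_≡_; refl; sym; trans; cong; cong₂; subst; module ≡-Reasoning)
open import Relation.Nullary using (yes; no; contradiction)

next-inject₁ : ∀ {n} (j : Fin n) → next (inject₁ j) ≡ suc j
next-inject₁ {n} j with toℕ (inject₁ j) <? n
... | yes j<n = cong suc (toℕ-injective (trans (toℕ-fromℕ< j<n) (toℕ-inject₁ j)))
... | no  j≮n = contradiction (subst (_< n) (sym (toℕ-inject₁ j)) (toℕ<n j)) j≮n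

next-fromℕ : ∀ n → next (fromℕ n) ≡ zero
next-fromℕ n with toℕ (fromℕ n) <? n
... | yes n<n = contradiction (subst (_< n) (toℕ-fromℕ n) n<n) (<-irrefl refl)
... | no  _   = refl

module _ {a ℓ} (M : CommutativeMonoid a ℓ) where
  open CommutativeMonoid M using (Carrier; _≈_; setoid; comm)
    renaming (_∙_ to _+_; refl to ≈-refl)
  open CommutativeMonoidSum M using (sum; sum-cong-≗; sum-init-last)
  open import Relation.Binary.Reasoning.Setoid setoid

  sum-∘next : ∀ {n} (g : Vector Carrier n) → sum (g ∘ next) ≈ sum g
  sum-∘next {zero}  g = ≈-refl
  sum-∘next {suc n} g = begin
    sum (g ∘ next)                         ≈⟨ sum-init-last (g ∘ next) ⟩
    sum (g ∘ next ∘ inject₁) + g (next (fromℕ n))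
      ≡⟨ cong₂ _+_ (sum-cong-≗ (cong g ∘ next-inject₁)) (cong g (next-fromℕ n)) ⟩
    sum (g ∘ suc) + g zero                 ≈⟨ comm _ _ ⟩
    sum g                                  ∎

xor-commutativeMonoid : CommutativeMonoid 0ℓ 0ℓ
xor-commutativeMonoid = CommutativeRing.+-commutativeMonoid xor-∧-commutativeRing

open CommutativeMonoidSum xor-commutativeMonoid
  using (sum; sum-syntax; sum-cong-≗; ∑-distrib-+; sum-replicate-zero)

∑-true≡false⇒2∣ : ∀ n → ∑[ i < n ] true ≡ false → 2 ∣ n
∑-true≡false⇒2∣ zero          _  = divides 0 refl
∑-true≡false⇒2∣ (suc zero)    ()
∑-true≡false⇒2∣ (suc (suc n)) ∑≡false =
  ∣m∣n⇒∣m+n ∣-refl (∑-true≡false⇒2∣ n (trans (sym (not-involutive _)) ∑≡false))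

-- every letter contains exactly two of the four directions
left∈≡right∈⊕up∈⊕down∈ : ∀ α → left ∈L α ≡ right ∈L α xor up ∈L α xor down ∈L α
left∈≡right∈⊕up∈⊕down∈ a = refl
left∈≡right∈⊕up∈⊕down∈ b = refl
left∈≡right∈⊕up∈⊕down∈ c = refl
left∈≡right∈⊕up∈⊕down∈ d = refl
left∈≡right∈⊕up∈⊕down∈ e = refl
left∈≡right∈⊕up∈⊕down∈ f = refl

leftParity rightParity : ∀ {m} → Vertex m → Bool
leftParity  {m} (w , _) = ∑[ i < m ] (left ∈L w i)
rightParity {m} (w , _) = ∑[ i < m ] (right ∈L w i)

leftParity≡rightParity : ∀ {m} (v : Vertex m) → leftParity v ≡ rightParity v
leftParity≡rightParity {m} (w , cyclic) = begin
  sum L                                   ≡⟨ sum-cong-≗ (left∈≡right∈⊕up∈⊕down∈ ∘ w) ⟩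
  ∑[ i < m ] (R i xor U i xor D i)        ≡⟨ ∑-distrib-+ R _ ⟩
  sum R xor ∑[ i < m ] (U i xor D i)      ≡⟨ cong (sum R xor_) (∑-distrib-+ U D) ⟩
  sum R xor sum U xor sum D               ≡⟨ cong (λ s → sum R xor sum U xor s) (sum-cong-≗ cyclic) ⟩
  sum R xor sum U xor sum (U ∘ next)
    ≡⟨ cong (λ s → sum R xor sum U xor s) (sum-∘next xor-commutativeMonoid U) ⟩
  sum R xor sum U xor sum U               ≡⟨ cong (sum R xor_) (xor-same (sum U)) ⟩
  sum R xor false                         ≡⟨ xor-identityʳ (sum R) ⟩
  sum R                                   ∎
  where
  open ≡-Reasoning
  L R U D : Fin m → Bool
  L i = left  ∈L w i
  R i = right ∈L w i
  U i = up    ∈L w i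
  D i = down  ∈L w i

leftParity-arc : ∀ {m} (v u : Vertex m) → Arc v u → leftParity v ≡ leftParity u
leftParity-arc v u v→u = trans (leftParity≡rightParity v) (sum-cong-≗ v→u)

leftParity-adj : ∀ {m} (v u : Vertex m) → Adj v u → leftParity v ≡ leftParity u
leftParity-adj v u (inj₁ v→u) = leftParity-arc v u v→u
leftParity-adj v u (inj₂ u→v) = sym (leftParity-arc u v u→v)

leftParity-component : ∀ {m} {v u : Vertex m} → SameComponent v u → leftParity v ≡ leftParity u
leftParity-component ε = refl
leftParity-component {v = v} (_◅_ {j = w} v~w w~u) =
  trans (leftParity-adj v w v~w) (leftParity-component w~u)

data InjectOrLast : ∀ {n} → Fin (suc n) → Set where
  inject : ∀ {n} (j : Fin n) → InjectOrLast (inject₁ j)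
  last   : ∀ n → InjectOrLast (fromℕ n)

injectOrLast : ∀ {n} (i : Fin (suc n)) → InjectOrLast i
injectOrLast {zero}  zero    = last zero
injectOrLast {suc n} zero    = inject zero
injectOrLast {suc n} (suc i) with injectOrLast i
... | inject j = inject (suc j)
... | last .n  = last (suc n)

parity-*2 : ∀ q → parity (q * 2) ≡ 0ℙ
parity-*2 zero    = refl
parity-*2 (suc q) = parity-*2 q

2∣suc⇒parity≡1ℙ : ∀ {n} → 2 ∣ suc n → parity n ≡ 1ℙ
2∣suc⇒parity≡1ℙ {n} (divides q 1+n≡q*2) = begin
  parity n               ≡⟨ suc-homo-⁻¹ n ⟨
  parity (suc n) ⁻¹      ≡⟨ cong (λ k → parity k ⁻¹) 1+n≡q*2 ⟩
  parity (q * 2) ⁻¹      ≡⟨ cong _⁻¹ (parity-*2 q) ⟩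
  1ℙ                     ∎
  where open ≡-Reasoning

alternatingLetter : Parity → Letter
alternatingLetter 0ℙ = d
alternatingLetter 1ℙ = f

alternatingLetter-arcUD : ∀ k →
  ArcUD (alternatingLetter (parity k)) (alternatingLetter (parity (suc k)))
alternatingLetter-arcUD zero          = refl
alternatingLetter-arcUD (suc zero)    = refl
alternatingLetter-arcUD (suc (suc k)) = alternatingLetter-arcUD k

e→alternatingLetter : ∀ p → ArcLR e (alternatingLetter p)
e→alternatingLetter 0ℙ = refl
e→alternatingLetter 1ℙ = refl

alternatingLetter→b : ∀ p → ArcLR (alternatingLetter p) b
alternatingLetter→b 0ℙ = refl
alternatingLetter→b 1ℙ = refl

alternating : ∀ n → parity n ≡ 1ℙ → Vertex (suc n)
alternating n n-odd = dfWord , cyclic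
  where
  dfWord : Word (suc n)
  dfWord i = alternatingLetter (parity (toℕ i))

  cyclic : ∀ i → ArcUD (dfWord i) (dfWord (next i))
  cyclic i with injectOrLast i
  ... | inject j rewrite next-inject₁ j | toℕ-inject₁ j = alternatingLetter-arcUD (toℕ j)
  ... | last .n  rewrite next-fromℕ n | toℕ-fromℕ n | n-odd = refl

eᵐ→alternating : ∀ n (n-odd : parity n ≡ 1ℙ) → Arc (eᵐ (suc n)) (alternating n n-odd)
eᵐ→alternating n n-odd = e→alternatingLetter ∘ parity ∘ toℕ

alternating→bᵐ : ∀ n (n-odd : parity n ≡ 1ℙ) → Arc (alternating n n-odd) (bᵐ (suc n))
alternating→bᵐ n n-odd = alternatingLetter→b ∘ parity ∘ toℕ

lemma6 : (m : ℕ) → m ≥ 1 → (SameComponent (eᵐ m) (bᵐ m) ⇔ 2 ∣ m)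
lemma6 (suc n) (s≤s z≤n) = mk⇔ even-if-connected connected-if-even
  where
  even-if-connected : SameComponent (eᵐ (suc n)) (bᵐ (suc n)) → 2 ∣ suc n
  even-if-connected eᵐ~bᵐ =
    ∑-true≡false⇒2∣ (suc n) (trans (leftParity-component eᵐ~bᵐ) (sum-replicate-zero (suc n)))

  connected-if-even : 2 ∣ suc n → SameComponent (eᵐ (suc n)) (bᵐ (suc n))
  connected-if-even 2∣1+n =
    _◅_ {j = alternating n n-odd}
      (inj₁ (eᵐ→alternating n n-odd)) (inj₁ (alternating→bᵐ n n-odd) ◅ ε)
    where
    n-odd : parity n ≡ 1ℙ
    n-odd = 2∣suc⇒parity≡1ℙ 2∣1+n
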